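{- Let $q\geq 17$ be an odd prime power, let $\mathcal{C}=\mathcal{Z}(XY-Z^2)$ be the conic of $\mathrm{PG}(2,q)$ with equation $XY-Z^2=0$, and let $H=\{(1,s^4,s^2)\mid s\in\mathbb{F}_q\}\subseteq\mathcal{C}$. Then every point $U=(0,b,c)$ with $bc\neq 0$ and every point $V=(a,0,c)$ with $ac\neq 0$ is $H$-covered.
   Context: $\mathrm{PG}(2,q)$ is the projective plane over the finite field $\mathbb{F}_q$, points in homogeneous coordinates. For a set of points $H$, a point of $\mathrm{PG}(2,q)\setminus H$ is called $H$-covered if it lies on a line joining two distinct points of $H$, and $H$-free otherwise. -}

module Defs where

open import Level using (0ℓ)
open import Data.Nat using (ℕ; suc; _≥_; _^_) renaming (_*_ to _*ℕ_)
open import Data.Nat.Primality using (Prime)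
open import Data.Fin using (Fin)
open import Data.Product using (Σ; ∃; ∃₂; _×_; _,_)
open import Relation.Binary.PropositionalEquality using (_≡_; _≢_; sym)
open import Relation.Nullary using (¬_)
open import Algebra.Structures using (IsCommutativeRing)
open import Function.Bundles using (_↔_)

IsPrimePower : ℕ → Set
IsPrimePower q = ∃₂ λ p k → Prime p × k ≥ 1 × q ≡ p ^ k

IsOdd : ℕ → Set
IsOdd q = Σ ℕ λ m → q ≡ suc (2 *ℕ m)

record FiniteField (q : ℕ) : Set₁ where
  infixl 6 _+_ _-_
  infixl 7 _*_
  infix 8 -_
  infix 9 _² _⁴
  field
    Carrier : Set
    _+_ _*_ : Carrier → Carrier → Carrier
    -_ : Carrier → Carrier
    0# 1# : Carrier
    isCommutativeRing : IsCommutativeRing _≡_ _+_ _*_ -_ 0# 1#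
    0≢1 : 0# ≢ 1#
    inverse : ∀ x → x ≢ 0# → Σ Carrier λ y → x * y ≡ 1#
    enumeration : Carrier ↔ Fin q

  _-_ : Carrier → Carrier → Carrier
  x - y = x + (- y)

  Triple : Set
  Triple = Carrier × Carrier × Carrier

  NonZero : Triple → Set
  NonZero (x , y , z) = ¬ (x ≡ 0# × y ≡ 0# × z ≡ 0#)

  -- a point of PG(2,q): a nonzero triple (taken up to proportionality)
  Point : Set
  Point = Σ Triple NonZero

  scale : Carrier → Triple → Triple
  scale λ' (x , y , z) = (λ' * x , λ' * y , λ' * z)

  SamePoint : Point → Point → Set
  SamePoint (u , _) (v , _) = Σ Carrier λ λ' → λ' ≢ 0# × u ≡ scale λ' v

  det : Triple → Triple → Triple → Carrier
  det (a₁ , a₂ , a₃) (b₁ , b₂ , b₃) (c₁ , c₂ , c₃) =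
    a₁ * (b₂ * c₃ - b₃ * c₂) - a₂ * (b₁ * c₃ - b₃ * c₁) + a₃ * (b₁ * c₂ - b₂ * c₁)

  Collinear : Point → Point → Point → Set
  Collinear (u , _) (v , _) (w , _) = det u v w ≡ 0#

  -- a point set, as a predicate on points (intended closed under SamePoint)
  PointSet : Set₁
  PointSet = Point → Set

  Covered : PointSet → Point → Set
  Covered H P = ¬ H P × (Σ Point λ Q → Σ Point λ R →
                  H Q × H R × ¬ SamePoint Q R × Collinear P Q R)

  Free : PointSet → Point → Set
  Free H P = ¬ H P × ¬ Covered H P

  _² : Carrier → Carrier
  x ² = x * x

  _⁴ : Carrier → Carrier
  x ⁴ = (x ²) ²

  OnConic : Point → Set
  OnConic ((x , y , z) , _) = x * y - z ² ≡ 0#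

  hpt-nz : (s : Carrier) → NonZero (1# , s ⁴ , s ²)
  hpt-nz s (e , _ , _) = 0≢1 (sym e)

  H : PointSet
  H P = Σ Carrier λ s → SamePoint P ((1# , s ⁴ , s ²) , hpt-nz s)

module Submission where

-- Both claims reduce to writing a nonzero d as s² + t² with s, t ≠ 0 and s² ≠ t². For P = (0,b,c)
-- resp. (a,0,c), the determinant of P, (1,s⁴,s²), (1,t⁴,t²) is (t² - s²)(c(s² + t²) - b) resp.
-- (t² - s²)(c(s² + t²) - a s²t²); take d = b/c, resp. d = a/c and s, t the inverses of such a pair.
-- By pigeonhole every d is a sum of two squares x² + y². A degenerate representation (a zero
-- term, or x² = y²) is repaired by rotating (x, y) by the point ((1 - m²), 2m)/(1 + m²) of the
-- unit circle, for m outside a set of at most nine bad values. In characteristic 2 every element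
-- is a square and one splits d = u + (d - u) instead.

open import Defs
open import Data.Nat using (ℕ; _≥_)
open import Data.Product using (_×_; _,_)
open import Relation.Binary.PropositionalEquality using (_≢_)

open import Level using (0ℓ)
open import Data.Nat as ℕ using (zero; suc; _<_)
import Data.Nat.Properties as ℕ
open import Data.Integer as ℤ using (ℤ; -[1+_])
import Data.Integer.Properties as ℤ
open import Data.Sign as Sign using (Sign)
open import Data.Maybe using (Maybe; just; nothing)
open import Data.Empty using (⊥; ⊥-elim)
open import Data.Fin as Fin using (Fin; zero; suc; toℕ)
import Data.Fin.Properties as Fin
open import Data.Vec using (Vec; []; _∷_; lookup)
open import Data.Vec.Relation.Unary.All using (All; []; _∷_; all?)
open import Data.Vec.Relation.Unary.All.Properties using (lookup⁻)
open import Data.Product using (∃; ∃₂; proj₁; proj₂)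
open import Data.Sum as Sum using (_⊎_; inj₁; inj₂; [_,_]′)
open import Function using (_∘_; Injective)
open import Function.Bundles using (_↔_; Inverse; Injection)
open import Function.Properties.Inverse using (↔⇒↣; ↔-sym)
open import Relation.Binary.PropositionalEquality
  using (_≡_; refl; sym; trans; cong; cong₂; subst; module ≡-Reasoning)
open import Relation.Binary.Definitions using (DecidableEquality)
open import Relation.Nullary using (Dec; yes; no; ¬_; contradiction; ¬?)
open import Relation.Nullary.Decidable using (map′; via-injection; decidable-stable)
open import Relation.Unary using (Pred; Decidable)
open import Algebra.Bundles using (CommutativeRing)
open import Algebra.Solver.Ring.AlmostCommutativeRing
  using (_-Raw-AlmostCommutative⟶_; fromCommutativeRing)

-- Algebra.Solver.Ring needs coefficients whose arithmetic computes; ℤ maps into every commutative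
-- ring. The optimised multiples make the constants 1 and 2 reduce to 1# and 1# + 1#.
module IntegerCoefficientRingSolver {c ℓ} (R : CommutativeRing c ℓ) where

  private
    open CommutativeRing R renaming (refl to ≈-refl; sym to ≈-sym; trans to ≈-trans)
    open import Algebra.Properties.Semiring.Mult.TCOptimised semiring
      using (1+×; ×-homo-+; ×1-homo-*) renaming (_×_ to _·_)
    open import Algebra.Properties.Group +-group using (ε⁻¹≈ε; ⁻¹-involutive)
    open import Algebra.Properties.AbelianGroup +-abelianGroup using (⁻¹-∙-comm)
    open import Algebra.Properties.Ring ring using (-1*x≈-x)
    open import Algebra.Properties.CommutativeSemigroup +-commutativeSemigroup
      using () renaming (interchange to +-interchange)
    open import Algebra.Properties.CommutativeSemigroup *-commutativeSemigroup
      using () renaming (interchange to *-interchange)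
    open import Relation.Binary.Reasoning.Setoid setoid

    ⟦_⟧ : ℤ → Carrier
    ⟦ ℤ.+ n ⟧    = n · 1#
    ⟦ -[1+ n ] ⟧ = - (suc n · 1#)

    1+a-[1+b]≈a-b : ∀ a b → (1# + a) - (1# + b) ≈ a - b
    1+a-[1+b]≈a-b a b = begin
      (1# + a) - (1# + b)      ≈⟨ +-congˡ (⁻¹-∙-comm 1# b) ⟨
      (1# + a) + (- 1# + - b)  ≈⟨ +-interchange 1# a (- 1#) (- b) ⟩
      (1# - 1#) + (a - b)      ≈⟨ +-congʳ (-‿inverseʳ 1#) ⟩
      0# + (a - b)             ≈⟨ +-identityˡ (a - b) ⟩
      a - b                    ∎

    ⊖-homo : ∀ m n → ⟦ m ℤ.⊖ n ⟧ ≈ m · 1# - n · 1#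
    ⊖-homo m       zero    = ≈-sym (≈-trans (+-congˡ ε⁻¹≈ε) (+-identityʳ _))
    ⊖-homo zero    (suc n) = ≈-sym (+-identityˡ _)
    ⊖-homo (suc m) (suc n) = begin
      ⟦ suc m ℤ.⊖ suc n ⟧            ≡⟨ cong ⟦_⟧ (ℤ.[1+m]⊖[1+n]≡m⊖n m n) ⟩
      ⟦ m ℤ.⊖ n ⟧                    ≈⟨ ⊖-homo m n ⟩
      m · 1# - n · 1#                ≈⟨ 1+a-[1+b]≈a-b (m · 1#) (n · 1#) ⟨
      (1# + m · 1#) - (1# + n · 1#)  ≈⟨ +-cong (1+× m 1#) (-‿cong (1+× n 1#)) ⟨
      suc m · 1# - suc n · 1#        ∎

    +-homo : ∀ i j → ⟦ i ℤ.+ j ⟧ ≈ ⟦ i ⟧ + ⟦ j ⟧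
    +-homo (ℤ.+ m)  (ℤ.+ n)  = ×-homo-+ 1# m n
    +-homo (ℤ.+ m)  -[1+ n ] = ⊖-homo m (suc n)
    +-homo -[1+ m ] (ℤ.+ n)  = ≈-trans (⊖-homo n (suc m)) (+-comm _ _)
    +-homo -[1+ m ] -[1+ n ] = begin
      - (suc (suc (m ℕ.+ n)) · 1#)     ≡⟨ cong (λ k → - (suc k · 1#)) (ℕ.+-suc m n) ⟨
      - ((suc m ℕ.+ suc n) · 1#)       ≈⟨ -‿cong (×-homo-+ 1# (suc m) (suc n)) ⟩
      - (suc m · 1# + suc n · 1#)      ≈⟨ ⁻¹-∙-comm _ _ ⟨
      - (suc m · 1#) + - (suc n · 1#)  ∎

    -‿homo : ∀ i → ⟦ ℤ.- i ⟧ ≈ - ⟦ i ⟧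
    -‿homo (ℤ.+ zero)  = ≈-sym ε⁻¹≈ε
    -‿homo (ℤ.+ suc n) = ≈-refl
    -‿homo -[1+ n ]    = ≈-sym (⁻¹-involutive _)

    ⟦_⟧ˢ : Sign → Carrier
    ⟦ Sign.+ ⟧ˢ = 1#
    ⟦ Sign.- ⟧ˢ = - 1#

    ◃-homo : ∀ s n → ⟦ s ℤ.◃ n ⟧ ≈ ⟦ s ⟧ˢ * (n · 1#)
    ◃-homo s      zero    = ≈-sym (zeroʳ _)
    ◃-homo Sign.+ (suc n) = ≈-sym (*-identityˡ _)
    ◃-homo Sign.- (suc n) = ≈-sym (-1*x≈-x _)

    sign-*-homo : ∀ s t → ⟦ s Sign.* t ⟧ˢ ≈ ⟦ s ⟧ˢ * ⟦ t ⟧ˢ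
    sign-*-homo Sign.- Sign.- = ≈-sym (≈-trans (-1*x≈-x _) (⁻¹-involutive _))
    sign-*-homo Sign.- Sign.+ = ≈-sym (*-identityʳ _)
    sign-*-homo Sign.+ Sign.- = ≈-sym (*-identityˡ _)
    sign-*-homo Sign.+ Sign.+ = ≈-sym (*-identityˡ _)

    sign-abs : ∀ i → ⟦ i ⟧ ≈ ⟦ ℤ.sign i ⟧ˢ * (ℤ.∣ i ∣ · 1#)
    sign-abs (ℤ.+ n)  = ≈-sym (*-identityˡ _)
    sign-abs -[1+ n ] = ≈-sym (-1*x≈-x _)

    *-homo : ∀ i j → ⟦ i ℤ.* j ⟧ ≈ ⟦ i ⟧ * ⟦ j ⟧
    *-homo i j = begin
      ⟦ (ℤ.sign i Sign.* ℤ.sign j) ℤ.◃ (ℤ.∣ i ∣ ℕ.* ℤ.∣ j ∣) ⟧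
        ≈⟨ ◃-homo (ℤ.sign i Sign.* ℤ.sign j) (ℤ.∣ i ∣ ℕ.* ℤ.∣ j ∣) ⟩
      ⟦ ℤ.sign i Sign.* ℤ.sign j ⟧ˢ * ((ℤ.∣ i ∣ ℕ.* ℤ.∣ j ∣) · 1#)
        ≈⟨ *-cong (sign-*-homo (ℤ.sign i) (ℤ.sign j)) (×1-homo-* ℤ.∣ i ∣ ℤ.∣ j ∣) ⟩
      (⟦ ℤ.sign i ⟧ˢ * ⟦ ℤ.sign j ⟧ˢ) * ((ℤ.∣ i ∣ · 1#) * (ℤ.∣ j ∣ · 1#))
        ≈⟨ *-interchange _ _ _ _ ⟩
      (⟦ ℤ.sign i ⟧ˢ * (ℤ.∣ i ∣ · 1#)) * (⟦ ℤ.sign j ⟧ˢ * (ℤ.∣ j ∣ · 1#))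
        ≈⟨ *-cong (sign-abs i) (sign-abs j) ⟨
      ⟦ i ⟧ * ⟦ j ⟧ ∎

    ℤ-homomorphism : ℤ.+-*-rawRing -Raw-AlmostCommutative⟶ fromCommutativeRing R
    ℤ-homomorphism = record
      { ⟦_⟧ = ⟦_⟧ ; +-homo = +-homo ; *-homo = *-homo ; -‿homo = -‿homo
      ; 0-homo = ≈-refl ; 1-homo = ≈-refl }

    ⟦⟧-≟ : ∀ i j → Maybe (⟦ i ⟧ ≈ ⟦ j ⟧)
    ⟦⟧-≟ i j with i ℤ.≟ j
    ... | yes i≡j = just (reflexive (cong ⟦_⟧ i≡j))
    ... | no  _   = nothing

  open import Algebra.Solver.Ring ℤ.+-*-rawRing (fromCommutativeRing R) ℤ-homomorphism ⟦⟧-≟ public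

module Enumeration {A : Set} {n : ℕ} (enumeration : A ↔ Fin n) where

  open Inverse enumeration using (to; from; strictlyInverseʳ)

  to-injective : Injective _≡_ _≡_ to
  to-injective = Injection.injective (↔⇒↣ enumeration)

  from-injective : Injective _≡_ _≡_ from
  from-injective = Injection.injective (↔⇒↣ (↔-sym enumeration))

  infix 4 _≟_
  _≟_ : DecidableEquality A
  _≟_ = via-injection (↔⇒↣ enumeration) Fin._≟_

  rank : A → ℕ
  rank = toℕ ∘ to

  rank-injective : Injective _≡_ _≡_ rank
  rank-injective = to-injective ∘ Fin.toℕ-injective

  ∃? : ∀ {p} {P : Pred A p} → Decidable P → Dec (∃ P)
  ∃? {P = P} P? = map′ (λ (i , p) → from i , p)
                       (λ (x , p) → to x , subst P (sym (strictlyInverseʳ x)) p)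
                       (Fin.any? (P? ∘ from))

  hit-or-collision : (a : A) (f : A → A) →
                     (∃ λ x → f x ≡ a) ⊎ (∃₂ λ x y → x ≢ y × f x ≡ f y)
  hit-or-collision a f with Fin.pigeonhole (ℕ.n<1+n n) g
    where
      g : Fin (suc n) → Fin n
      g zero    = to a
      g (suc i) = to (f (from i))
  ... | zero  , suc j , _   , e = inj₁ (from j , sym (to-injective e))
  ... | suc i , suc j , i<j , e =
        inj₂ (from i , from j , (λ i≡j → Fin.<-irrefl (cong suc (from-injective i≡j)) i<j) , to-injective e)

  avoid : ∀ {k} → k < n → (xs : Vec A k) → ∃ λ a → All (_≢ a) xs
  avoid {k} k<n xs with ∃? (λ a → all? (λ x → ¬? (x ≟ a)) xs)
  ... | yes found = found
  ... | no  none  = contradiction (Fin.injective⇒≤ position-injective) (ℕ.<⇒≱ k<n)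
    where
      position : ∀ i → ∃ λ j → lookup xs j ≡ from i
      position i with Fin.¬∀⟶∃¬ k (λ j → lookup xs j ≢ from i) (λ j → ¬? (lookup xs j ≟ from i))
                                  (λ ≢i → none (from i , lookup⁻ ≢i))
      ... | j , ¬≢ = j , decidable-stable (lookup xs j ≟ from i) ¬≢

      position-injective : Injective _≡_ _≡_ (proj₁ ∘ position)
      position-injective {i} {i′} j≡j′ = from-injective (begin
        from i                         ≡⟨ proj₂ (position i) ⟨
        lookup xs (proj₁ (position i))  ≡⟨ cong (lookup xs) j≡j′ ⟩
        lookup xs (proj₁ (position i′)) ≡⟨ proj₂ (position i′) ⟩
        from i′                        ∎)
        where open ≡-Reasoning

module _ {q : ℕ} (F : FiniteField q) where

  open FiniteField F
  open Enumeration enumeration using (_≟_; rank; rank-injective; ∃?; hit-or-collision; avoid)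

  commutativeRing : CommutativeRing 0ℓ 0ℓ
  commutativeRing = record { isCommutativeRing = isCommutativeRing }

  open CommutativeRing commutativeRing
    using (+-identityˡ; +-identityʳ; *-identityˡ; *-identityʳ; *-comm; zeroˡ; zeroʳ; -‿inverseʳ; +-group)
  open import Algebra.Properties.Group +-group
    using (ε⁻¹≈ε; ⁻¹-involutive; x∙y⁻¹≈ε⇒x≈y; x≈y⇒x∙y⁻¹≈ε)
  open IntegerCoefficientRingSolver commutativeRing
    using (Polynomial; solve; _:=_; _:+_; _:*_; _:-_; :-_; con)

  two : Carrier
  two = 1# + 1#

  0ᴾ 1ᴾ 2ᴾ : ∀ {n} → Polynomial n
  0ᴾ = con (ℤ.+ 0)
  1ᴾ = con (ℤ.+ 1)
  2ᴾ = con (ℤ.+ 2)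

  x-y≡0⇒x≡y : ∀ {x y} → x - y ≡ 0# → x ≡ y
  x-y≡0⇒x≡y = x∙y⁻¹≈ε⇒x≈y _ _

  x≡y⇒x-y≡0 : ∀ {x y} → x ≡ y → x - y ≡ 0#
  x≡y⇒x-y≡0 = x≈y⇒x∙y⁻¹≈ε

  x-0≡x : ∀ x → x - 0# ≡ x
  x-0≡x x = trans (cong (x +_) ε⁻¹≈ε) (+-identityʳ x)

  d-x≡d-y⇒x≡y : ∀ {d x y} → d - x ≡ d - y → x ≡ y
  d-x≡d-y⇒x≡y {d} {x} {y} d-x≡d-y = begin
    x              ≡⟨ d-[d-x]≡x x ⟨
    d - (d - x)    ≡⟨ cong (λ u → d - u) d-x≡d-y ⟩
    d - (d - y)    ≡⟨ d-[d-x]≡x y ⟩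
    y              ∎
    where
      open ≡-Reasoning
      d-[d-x]≡x : ∀ x → d - (d - x) ≡ x
      d-[d-x]≡x = solve 2 (λ d x → d :- (d :- x) := x) refl d

  ≢-by-difference : ∀ {x y k} → x - y ≡ k → k ≢ 0# → x ≢ y
  ≢-by-difference x-y≡k k≢0 x≡y = k≢0 (trans (sym x-y≡k) (x≡y⇒x-y≡0 x≡y))

  x*[w*y]≡y : ∀ {x w} y → x * w ≡ 1# → x * (w * y) ≡ y
  x*[w*y]≡y {x} {w} y xw≡1 = begin
    x * (w * y)  ≡⟨ solve 3 (λ x w y → x :* (w :* y) := (x :* w) :* y) refl x w y ⟩
    (x * w) * y  ≡⟨ cong (_* y) xw≡1 ⟩
    1# * y       ≡⟨ *-identityˡ y ⟩
    y            ∎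
    where open ≡-Reasoning

  *-cancelˡ : ∀ {x y z} → x ≢ 0# → x * y ≡ x * z → y ≡ z
  *-cancelˡ {x} {y} {z} x≢0 xy≡xz with inverse x x≢0
  ... | w , xw≡1 = begin
    y            ≡⟨ x*[w*y]≡y y wx≡1 ⟨
    w * (x * y)  ≡⟨ cong (w *_) xy≡xz ⟩
    w * (x * z)  ≡⟨ x*[w*y]≡y z wx≡1 ⟩
    z            ∎
    where open ≡-Reasoning
          wx≡1 = trans (*-comm w x) xw≡1

  x*y≡0⇒x≡0⊎y≡0 : ∀ {x y} → x * y ≡ 0# → x ≡ 0# ⊎ y ≡ 0#
  x*y≡0⇒x≡0⊎y≡0 {x} {y} xy≡0 with x ≟ 0#
  ... | yes x≡0 = inj₁ x≡0
  ... | no  x≢0 = inj₂ (*-cancelˡ x≢0 (trans xy≡0 (sym (zeroʳ x))))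

  x*y≢0 : ∀ {x y} → x ≢ 0# → y ≢ 0# → x * y ≢ 0#
  x*y≢0 x≢0 y≢0 = [ x≢0 , y≢0 ]′ ∘ x*y≡0⇒x≡0⊎y≡0

  x*y≡1⇒x≢0 : ∀ {x y} → x * y ≡ 1# → x ≢ 0#
  x*y≡1⇒x≢0 {x} {y} xy≡1 x≡0 = 0≢1 (begin
    0#      ≡⟨ zeroˡ y ⟨
    0# * y  ≡⟨ cong (_* y) x≡0 ⟨
    x * y   ≡⟨ xy≡1 ⟩
    1#      ∎)
    where open ≡-Reasoning

  x*y≢0⇒x≢0 : ∀ {x y} → x * y ≢ 0# → x ≢ 0#
  x*y≢0⇒x≢0 {x} {y} xy≢0 x≡0 = xy≢0 (trans (cong (_* y) x≡0) (zeroˡ y))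

  x*y≢0⇒y≢0 : ∀ {x y} → x * y ≢ 0# → y ≢ 0#
  x*y≢0⇒y≢0 {x} {y} xy≢0 y≡0 = xy≢0 (trans (cong (x *_) y≡0) (zeroʳ x))

  inverse-unique : ∀ {x y z} → x * y ≡ 1# → x * z ≡ 1# → y ≡ z
  inverse-unique xy≡1 xz≡1 = *-cancelˡ (x*y≡1⇒x≢0 xy≡1) (trans xy≡1 (sym xz≡1))

  [xy]²≡x²y² : ∀ x y → (x * y) ² ≡ x ² * y ²
  [xy]²≡x²y² = solve 2 (λ x y → (x :* y) :* (x :* y) := (x :* x) :* (y :* y)) refl

  -x≢0 : ∀ {x} → x ≢ 0# → - x ≢ 0#
  -x≢0 {x} x≢0 -x≡0 = x≢0 (trans (sym (⁻¹-involutive x)) (trans (cong -_ -x≡0) ε⁻¹≈ε))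

  x²≡0⇒x≡0 : ∀ {x} → x ² ≡ 0# → x ≡ 0#
  x²≡0⇒x≡0 x²≡0 = Sum.reduce (x*y≡0⇒x≡0⊎y≡0 x²≡0)

  x²≡y²⇒x≡±y : ∀ {x y} → x ² ≡ y ² → x ≡ y ⊎ x ≡ - y
  x²≡y²⇒x≡±y {x} {y} x²≡y² = Sum.map x-y≡0⇒x≡y x+y≡0⇒x≡-y (x*y≡0⇒x≡0⊎y≡0 (begin
    (x - y) * (x + y)  ≡⟨ solve 2 (λ x y → (x :- y) :* (x :+ y) := x :* x :- y :* y) refl x y ⟩
    x ² - y ²          ≡⟨ x≡y⇒x-y≡0 x²≡y² ⟩
    0#                 ∎))
    where
      open ≡-Reasoning
      x+y≡0⇒x≡-y : x + y ≡ 0# → x ≡ - y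
      x+y≡0⇒x≡-y x+y≡0 = begin
        x            ≡⟨ solve 2 (λ x y → x := (x :+ y) :- y) refl x y ⟩
        (x + y) - y  ≡⟨ cong (_- y) x+y≡0 ⟩
        0# - y       ≡⟨ +-identityˡ (- y) ⟩
        - y          ∎

  -- Sums of two squares

  Canonical : Carrier → Set
  Canonical x = rank x ℕ.≤ rank (- x)

  canonical? : ∀ x → Dec (Canonical x)
  canonical? x = rank x ℕ.≤? rank (- x)

  canonical-0 : Canonical 0#
  canonical-0 = ℕ.≤-reflexive (cong rank (sym ε⁻¹≈ε))

  canonical-both : ∀ {x} → Canonical x → Canonical (- x) → x ≡ - x
  canonical-both {x} x≤-x -x≤x = rank-injective (ℕ.≤-antisym x≤-x
    (subst (λ y → rank (- x) ℕ.≤ rank y) (⁻¹-involutive x) -x≤x))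

  canonical-neither : ∀ {x} → ¬ Canonical x → ¬ Canonical (- x) → ⊥
  canonical-neither {x} x≰-x -x≰x = ℕ.<-asym (ℕ.≰⇒> x≰-x)
    (subst (λ y → rank y ℕ.< rank (- x)) (⁻¹-involutive x) (ℕ.≰⇒> -x≰x))

  SumOfTwoSquares : Carrier → Set
  SumOfTwoSquares d = ∃₂ λ x y → x ² + y ² ≡ d

  -- Pigeonhole on the q + 1 values d and φ x (x ∈ F): as φ is x² on one element of each
  -- pair {x, - x} and d - x² on the other, any coincidence writes d as x² + y².
  module _ (d : Carrier) where

    φ : (x : Carrier) → Dec (Canonical x) → Carrier
    φ x (yes _) = x ²
    φ x (no  _) = d - x ²

    hit⇒sum : ∀ x (c : Dec (Canonical x)) → φ x c ≡ d → SumOfTwoSquares d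
    hit⇒sum x (yes _) x²≡d = x , 0# ,
      trans (solve 1 (λ x → x :* x :+ 0ᴾ :* 0ᴾ := x :* x) refl x) x²≡d
    hit⇒sum x (no x≰-x) d-x²≡d = contradiction (subst Canonical (sym x≡0) canonical-0) x≰-x
      where x≡0 = x²≡0⇒x≡0 (d-x≡d-y⇒x≡y (trans d-x²≡d (sym (x-0≡x d))))

    collision⇒sum : ∀ x y (cx : Dec (Canonical x)) (cy : Dec (Canonical y)) →
                    x ≢ y → φ x cx ≡ φ y cy → SumOfTwoSquares d
    collision⇒sum x y (yes x≤-x) (yes y≤-y) x≢y x²≡y² with x²≡y²⇒x≡±y x²≡y²
    ... | inj₁ x≡y  = contradiction x≡y x≢y
    ... | inj₂ x≡-y = contradiction (trans x≡-y (sym (canonical-both y≤-y (subst Canonical x≡-y x≤-x)))) x≢y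
    collision⇒sum x y (no x≰-x) (no y≰-y) x≢y d-x²≡d-y² with x²≡y²⇒x≡±y (d-x≡d-y⇒x≡y d-x²≡d-y²)
    ... | inj₁ x≡y  = contradiction x≡y x≢y
    ... | inj₂ x≡-y = ⊥-elim (canonical-neither y≰-y (subst (¬_ ∘ Canonical) x≡-y x≰-x))
    collision⇒sum x y (yes _) (no _) _ x²≡d-y² = x , y , (begin
      x ² + y ²        ≡⟨ cong (_+ y ²) x²≡d-y² ⟩
      d - y ² + y ²    ≡⟨ solve 2 (λ d u → d :- u :+ u := d) refl d (y ²) ⟩
      d                ∎)
      where open ≡-Reasoning
    collision⇒sum x y (no _) (yes _) _ d-x²≡y² = y , x , (begin
      y ² + x ²        ≡⟨ cong (_+ x ²) d-x²≡y² ⟨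
      d - x ² + x ²    ≡⟨ solve 2 (λ d u → d :- u :+ u := d) refl d (x ²) ⟩
      d                ∎)
      where open ≡-Reasoning

  sum-of-two-squares : ∀ d → SumOfTwoSquares d
  sum-of-two-squares d with hit-or-collision d (λ x → φ d x (canonical? x))
  ... | inj₁ (x , φx≡d)             = hit⇒sum d x (canonical? x) φx≡d
  ... | inj₂ (x , y , x≢y , φx≡φy)  = collision⇒sum d x y (canonical? x) (canonical? y) x≢y φx≡φy

  -- Proper sums of two squares

  record ProperSumOfTwoSquares (d : Carrier) : Set where
    field
      s t     : Carrier
      s≢0     : s ≢ 0#
      t≢0     : t ≢ 0#
      s²≢t²   : s ² ≢ t ²
      s²+t²≡d : s ² + t ² ≡ d

  unscale : ∀ {c d p r} → c ≢ 0# → p ≢ 0# → r ≢ 0# → p ² ≢ r ² →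
            p ² + r ² ≡ c ² * d → ProperSumOfTwoSquares d
  unscale {c} {d} {p} {r} c≢0 p≢0 r≢0 p²≢r² p²+r²≡c²d with inverse c c≢0
  ... | w , cw≡1 = record
    { s       = w * p
    ; t       = w * r
    ; s≢0     = x*y≢0 w≢0 p≢0
    ; t≢0     = x*y≢0 w≢0 r≢0
    ; s²≢t²   = λ s²≡t² → p²≢r² (begin
        p ²              ≡⟨ cong _² (x*[w*y]≡y p cw≡1) ⟨
        (c * (w * p)) ²  ≡⟨ [xy]²≡x²y² c (w * p) ⟩
        c ² * (w * p) ²  ≡⟨ cong (c ² *_) s²≡t² ⟩
        c ² * (w * r) ²  ≡⟨ [xy]²≡x²y² c (w * r) ⟨
        (c * (w * r)) ²  ≡⟨ cong _² (x*[w*y]≡y r cw≡1) ⟩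
        r ²              ∎)
    ; s²+t²≡d = *-cancelˡ (x*y≢0 c≢0 c≢0) (begin
        c ² * ((w * p) ² + (w * r) ²)      ≡⟨ c²[x²+y²]≡[cx]²+[cy]² c (w * p) (w * r) ⟩
        (c * (w * p)) ² + (c * (w * r)) ²  ≡⟨ cong₂ (λ u v → u ² + v ²) (x*[w*y]≡y p cw≡1) (x*[w*y]≡y r cw≡1) ⟩
        p ² + r ²                          ≡⟨ p²+r²≡c²d ⟩
        c ² * d                            ∎)
    }
    where
      open ≡-Reasoning
      w≢0 : w ≢ 0#
      w≢0 = x*y≡1⇒x≢0 (trans (*-comm w c) cw≡1)
      c²[x²+y²]≡[cx]²+[cy]² : ∀ c x y → c ² * (x ² + y ²) ≡ (c * x) ² + (c * y) ²
      c²[x²+y²]≡[cx]²+[cy]² = solve 3 (λ c x y →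
        (c :* c) :* (x :* x :+ y :* y) := (c :* x) :* (c :* x) :+ (c :* y) :* (c :* y)) refl

  -- The m for which rotating (e, 0) and (x, x) by ((1 - m²), 2m)/(1 + m²) gives proper
  -- representations of e² and of x² + x².
  record Admissible (m : Carrier) : Set where
    field
      m≢0       : m ≢ 0#
      1-m²≢0    : 1# - m ² ≢ 0#
      1-m²-2m≢0 : 1# - m ² - two * m ≢ 0#
      1-m²+2m≢0 : 1# - m ² + two * m ≢ 0#
      1+m²≢0    : 1# + m ² ≢ 0#

  module _ {m} (2≢0 : two ≢ 0#) (admissible : Admissible m) where
    open Admissible admissible

    square⇒proper : ∀ {e d} → d ≢ 0# → e ² ≡ d → ProperSumOfTwoSquares d
    square⇒proper {e} d≢0 refl = unscale 1+m²≢0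
      (x*y≢0 1-m²≢0 e≢0) (x*y≢0 (x*y≢0 2≢0 m≢0) e≢0)
      (≢-by-difference p²-r² (x*y≢0 (x*y≢0 1-m²-2m≢0 1-m²+2m≢0) (x*y≢0 e≢0 e≢0)))
      p²+r²
      where
        e≢0 : e ≢ 0#
        e≢0 e≡0 = d≢0 (trans (cong _² e≡0) (zeroˡ 0#))
        p²+r² : ((1# - m ²) * e) ² + ((two * m) * e) ² ≡ (1# + m ²) ² * e ²
        p²+r² = solve 2 (λ m e →
          ((1ᴾ :- m :* m) :* e) :* ((1ᴾ :- m :* m) :* e) :+ ((2ᴾ :* m) :* e) :* ((2ᴾ :* m) :* e)
          := ((1ᴾ :+ m :* m) :* (1ᴾ :+ m :* m)) :* (e :* e)) refl m e
        p²-r² : ((1# - m ²) * e) ² - ((two * m) * e) ² ≡ ((1# - m ² - two * m) * (1# - m ² + two * m)) * e ²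
        p²-r² = solve 2 (λ m e →
          ((1ᴾ :- m :* m) :* e) :* ((1ᴾ :- m :* m) :* e) :- ((2ᴾ :* m) :* e) :* ((2ᴾ :* m) :* e)
          := ((1ᴾ :- m :* m :- 2ᴾ :* m) :* (1ᴾ :- m :* m :+ 2ᴾ :* m)) :* (e :* e)) refl m e

    double-square⇒proper : ∀ {x d} → d ≢ 0# → x ² + x ² ≡ d → ProperSumOfTwoSquares d
    double-square⇒proper {x} d≢0 refl = unscale 1+m²≢0
      (x*y≢0 1-m²-2m≢0 x≢0) (x*y≢0 1-m²+2m≢0 x≢0)
      (≢-by-difference p²-r² (x*y≢0 (x*y≢0 (-x≢0 (x*y≢0 (x*y≢0 2≢0 2≢0) 2≢0)) (x*y≢0 m≢0 1-m²≢0)) (x*y≢0 x≢0 x≢0)))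
      p²+r²
      where
        x≢0 : x ≢ 0#
        x≢0 x≡0 = d≢0 (trans (cong (λ u → u ² + u ²) x≡0)
                             (trans (cong₂ _+_ (zeroˡ 0#) (zeroˡ 0#)) (+-identityʳ 0#)))
        p²+r² : ((1# - m ² - two * m) * x) ² + ((1# - m ² + two * m) * x) ² ≡ (1# + m ²) ² * (x ² + x ²)
        p²+r² = solve 2 (λ m x →
          ((1ᴾ :- m :* m :- 2ᴾ :* m) :* x) :* ((1ᴾ :- m :* m :- 2ᴾ :* m) :* x)
            :+ ((1ᴾ :- m :* m :+ 2ᴾ :* m) :* x) :* ((1ᴾ :- m :* m :+ 2ᴾ :* m) :* x)
          := ((1ᴾ :+ m :* m) :* (1ᴾ :+ m :* m)) :* (x :* x :+ x :* x)) refl m x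
        p²-r² : ((1# - m ² - two * m) * x) ² - ((1# - m ² + two * m) * x) ²
                ≡ ((- (two * two * two)) * (m * (1# - m ²))) * x ²
        p²-r² = solve 2 (λ m x →
          ((1ᴾ :- m :* m :- 2ᴾ :* m) :* x) :* ((1ᴾ :- m :* m :- 2ᴾ :* m) :* x)
            :- ((1ᴾ :- m :* m :+ 2ᴾ :* m) :* x) :* ((1ᴾ :- m :* m :+ 2ᴾ :* m) :* x)
          := ((:- (2ᴾ :* 2ᴾ :* 2ᴾ)) :* (m :* (1ᴾ :- m :* m))) :* (x :* x)) refl m x

    proper-sum-of-two-squares-odd : ∀ {d} → d ≢ 0# → ProperSumOfTwoSquares d
    proper-sum-of-two-squares-odd {d} d≢0 with sum-of-two-squares d
    ... | x , y , x²+y²≡d with x ≟ 0# | y ≟ 0# | x ² ≟ y ²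
    ... | yes x≡0 | _       | _       = square⇒proper d≢0 (begin
      y ²             ≡⟨ trans (cong (_+ y ²) (zeroˡ 0#)) (+-identityˡ (y ²)) ⟨
      0# ² + y ²      ≡⟨ cong (λ u → u ² + y ²) x≡0 ⟨
      x ² + y ²       ≡⟨ x²+y²≡d ⟩
      d               ∎)
      where open ≡-Reasoning
    ... | no _    | yes y≡0 | _       = square⇒proper d≢0 (begin
      x ²             ≡⟨ trans (cong (x ² +_) (zeroˡ 0#)) (+-identityʳ (x ²)) ⟨
      x ² + 0# ²      ≡⟨ cong (λ u → x ² + u ²) y≡0 ⟨
      x ² + y ²       ≡⟨ x²+y²≡d ⟩
      d               ∎)
      where open ≡-Reasoning
    ... | no _    | no _    | yes x²≡y² = double-square⇒proper d≢0 (trans (cong (x ² +_) x²≡y²) x²+y²≡d)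
    ... | no x≢0  | no y≢0  | no x²≢y²  = record
      { s = x ; t = y ; s≢0 = x≢0 ; t≢0 = y≢0 ; s²≢t² = x²≢y² ; s²+t²≡d = x²+y²≡d }

  module _ (2≡0 : two ≡ 0#) where

    square-root-char2 : ∀ w → ∃ λ s → s ² ≡ w
    square-root-char2 w with sum-of-two-squares w
    ... | x , y , x²+y²≡w = x + y , (begin
      (x + y) ²                  ≡⟨ solve 2 (λ x y → (x :+ y) :* (x :+ y)
                                      := x :* x :+ y :* y :+ 2ᴾ :* (x :* y)) refl x y ⟩
      x ² + y ² + two * (x * y)  ≡⟨ cong (λ k → x ² + y ² + k * (x * y)) 2≡0 ⟩
      x ² + y ² + 0# * (x * y)   ≡⟨ cong (x ² + y ² +_) (zeroˡ (x * y)) ⟩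
      x ² + y ² + 0#             ≡⟨ +-identityʳ (x ² + y ²) ⟩
      x ² + y ²                  ≡⟨ x²+y²≡w ⟩
      w                          ∎)
      where open ≡-Reasoning

    proper-sum-of-two-squares-char2 : 2 < q → ∀ {d} → d ≢ 0# → ProperSumOfTwoSquares d
    proper-sum-of-two-squares-char2 2<q {d} d≢0 with avoid 2<q (0# ∷ d ∷ [])
    ... | u , 0≢u ∷ d≢u ∷ [] = record
      { s = s ; t = t
      ; s≢0     = λ s≡0 → 0≢u (trans (sym (zeroˡ 0#)) (trans (cong _² (sym s≡0)) s²≡u))
      ; t≢0     = λ t≡0 → d≢u (x-y≡0⇒x≡y (trans (sym t²≡d-u) (trans (cong _² t≡0) (zeroˡ 0#))))
      ; s²≢t²   = λ s²≡t² → d≢0 (d≡0 (trans (sym s²≡u) (trans s²≡t² t²≡d-u)))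
      ; s²+t²≡d = trans (cong₂ _+_ s²≡u t²≡d-u) (solve 2 (λ d u → u :+ (d :- u) := d) refl d u)
      }
      where
        open ≡-Reasoning
        s = proj₁ (square-root-char2 u)
        s²≡u = proj₂ (square-root-char2 u)
        t = proj₁ (square-root-char2 (d - u))
        t²≡d-u = proj₂ (square-root-char2 (d - u))
        d≡0 : u ≡ d - u → d ≡ 0#
        d≡0 u≡d-u = begin
          d            ≡⟨ solve 2 (λ d u → d := (d :- u) :+ u) refl d u ⟩
          (d - u) + u  ≡⟨ cong (_+ u) u≡d-u ⟨
          u + u        ≡⟨ solve 1 (λ u → u :+ u := 2ᴾ :* u) refl u ⟩
          two * u      ≡⟨ cong (_* u) 2≡0 ⟩
          0# * u       ≡⟨ zeroˡ u ⟩
          0#           ∎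

  square-roots : ∀ c → ∃ λ r → ∀ w → w ² ≡ c → w ≡ r ⊎ w ≡ - r
  square-roots c with ∃? (λ r → r ² ≟ c)
  ... | yes (r , r²≡c) = r , λ w w²≡c → x²≡y²⇒x≡±y (trans w²≡c (sym r²≡c))
  ... | no  ∄r         = 0# , λ w w²≡c → contradiction (w , w²≡c) ∄r

  drop-vanishing-term : ∀ {x c k p} → x ≡ c + k * p → p ≡ 0# → x ≡ c
  drop-vanishing-term {x} {c} {k} {p} x≡c+kp p≡0 = begin
    x           ≡⟨ x≡c+kp ⟩
    c + k * p   ≡⟨ cong (λ u → c + k * u) p≡0 ⟩
    c + k * 0#  ≡⟨ cong (c +_) (zeroʳ k) ⟩
    c + 0#      ≡⟨ +-identityʳ c ⟩
    c           ∎
    where open ≡-Reasoning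

  -- The roots of 1 - m², 1 - m² - 2m, 1 - m² + 2m and 1 + m² are among ±1, ±√2 - 1, ±√2 + 1, ±√-1.
  admissible : 9 < q → ∃ Admissible
  admissible 9<q with square-roots (- 1#) | square-roots two
  ... | i , √-1 | r , √2
      with avoid 9<q (0# ∷ 1# ∷ - 1# ∷ r - 1# ∷ - r - 1# ∷ r + 1# ∷ - r + 1# ∷ i ∷ - i ∷ [])
  ... | m , 0≢m ∷ 1≢m ∷ -1≢m ∷ r-1≢m ∷ -r-1≢m ∷ r+1≢m ∷ -r+1≢m ∷ i≢m ∷ -i≢m ∷ [] = m , record
    { m≢0       = 0≢m ∘ sym
    ; 1-m²≢0    = λ A≡0 → [ 1≢m ∘ sym , -1≢m ∘ sym ]′
        (x²≡y²⇒x≡±y (drop-vanishing-term (solve 1 (λ m →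
           m :* m := 1ᴾ :* 1ᴾ :+ (:- 1ᴾ) :* (1ᴾ :- m :* m)) refl m) A≡0))
    ; 1-m²-2m≢0 = λ B≡0 → [ r-1≢m ∘ sym ∘ m+1≡z⇒m≡z-1 , -r-1≢m ∘ sym ∘ m+1≡z⇒m≡z-1 ]′
        (√2 (m + 1#) (drop-vanishing-term (solve 1 (λ m →
           (m :+ 1ᴾ) :* (m :+ 1ᴾ) := 2ᴾ :+ (:- 1ᴾ) :* (1ᴾ :- m :* m :- 2ᴾ :* m)) refl m) B≡0))
    ; 1-m²+2m≢0 = λ C≡0 → [ r+1≢m ∘ sym ∘ m-1≡z⇒m≡z+1 , -r+1≢m ∘ sym ∘ m-1≡z⇒m≡z+1 ]′
        (√2 (m - 1#) (drop-vanishing-term (solve 1 (λ m →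
           (m :- 1ᴾ) :* (m :- 1ᴾ) := 2ᴾ :+ (:- 1ᴾ) :* (1ᴾ :- m :* m :+ 2ᴾ :* m)) refl m) C≡0))
    ; 1+m²≢0    = λ D≡0 → [ i≢m ∘ sym , -i≢m ∘ sym ]′
        (√-1 m (drop-vanishing-term (solve 1 (λ m →
           m :* m := :- 1ᴾ :+ 1ᴾ :* (1ᴾ :+ m :* m)) refl m) D≡0))
    }
    where
      m+1≡z⇒m≡z-1 : ∀ {z} → m + 1# ≡ z → m ≡ z - 1#
      m+1≡z⇒m≡z-1 {z} m+1≡z = trans (solve 1 (λ m → m := (m :+ 1ᴾ) :- 1ᴾ) refl m) (cong (_- 1#) m+1≡z)
      m-1≡z⇒m≡z+1 : ∀ {z} → m - 1# ≡ z → m ≡ z + 1#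
      m-1≡z⇒m≡z+1 {z} m-1≡z = trans (solve 1 (λ m → m := (m :- 1ᴾ) :+ 1ᴾ) refl m) (cong (_+ 1#) m-1≡z)

  proper-sum-of-two-squares : 9 < q → ∀ {d} → d ≢ 0# → ProperSumOfTwoSquares d
  proper-sum-of-two-squares 9<q with two ≟ 0#
  ... | yes 2≡0 = proper-sum-of-two-squares-char2 2≡0 (ℕ.≤-trans (ℕ.m≤m+n 3 7) 9<q)
  ... | no  2≢0 = proper-sum-of-two-squares-odd 2≢0 (proj₂ (admissible 9<q))

  -- Covering U and V by chords of H

  reciprocal-squares : ∀ {s t s′ t′} → s * s′ ≡ 1# → t * t′ ≡ 1# →
                       s ² + t ² ≡ (s′ ² + t′ ²) * (s ² * t ²)
  reciprocal-squares {s} {t} {s′} {t′} ss′≡1 tt′≡1 = sym (begin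
    (s′ ² + t′ ²) * (s ² * t ²)            ≡⟨ solve 4 (λ s t s′ t′ →
        (s′ :* s′ :+ t′ :* t′) :* ((s :* s) :* (t :* t))
        := ((s :* s′) :* (s :* s′)) :* (t :* t) :+ ((t :* t′) :* (t :* t′)) :* (s :* s)) refl s t s′ t′ ⟩
    (s * s′) ² * t ² + (t * t′) ² * s ²    ≡⟨ cong₂ (λ u v → u ² * t ² + v ² * s ²) ss′≡1 tt′≡1 ⟩
    1# ² * t ² + 1# ² * s ²                ≡⟨ solve 2 (λ s t → (1ᴾ :* 1ᴾ) :* (t :* t) :+ (1ᴾ :* 1ᴾ) :* (s :* s)
                                                := s :* s :+ t :* t) refl s t ⟩
    s ² + t ²                              ∎)
    where open ≡-Reasoning

  reciprocal-representation : ∀ {d} → ProperSumOfTwoSquares d →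
                              ∃₂ λ s t → s ² ≢ t ² × s ² + t ² ≡ d * (s ² * t ²)
  reciprocal-representation {d} proper = s , t , s²≢t² , (begin
    s ² + t ²                    ≡⟨ reciprocal-squares ss′≡1 tt′≡1 ⟩
    (s′ ² + t′ ²) * (s ² * t ²)  ≡⟨ cong (_* (s ² * t ²)) s′²+t′²≡d ⟩
    d * (s ² * t ²)              ∎)
    where
      open ≡-Reasoning
      open ProperSumOfTwoSquares proper
        renaming (s to s′; t to t′; s≢0 to s′≢0; t≢0 to t′≢0; s²≢t² to s′²≢t′²; s²+t²≡d to s′²+t′²≡d)
      s = proj₁ (inverse s′ s′≢0)
      t = proj₁ (inverse t′ t′≢0)
      ss′≡1 : s * s′ ≡ 1#
      ss′≡1 = trans (*-comm s s′) (proj₂ (inverse s′ s′≢0))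
      tt′≡1 : t * t′ ≡ 1#
      tt′≡1 = trans (*-comm t t′) (proj₂ (inverse t′ t′≢0))
      x²y²≡1 : ∀ {x y} → x * y ≡ 1# → x ² * y ² ≡ 1#
      x²y²≡1 {x} {y} xy≡1 = trans (sym ([xy]²≡x²y² x y)) (trans (cong _² xy≡1) (*-identityˡ 1#))
      s²≢t² : s ² ≢ t ²
      s²≢t² s²≡t² = s′²≢t′² (inverse-unique (x²y²≡1 ss′≡1)
                                (subst (λ u → u * t′ ² ≡ 1#) (sym s²≡t²) (x²y²≡1 tt′≡1)))

  conicPoint : Carrier → Point
  conicPoint s = (1# , s ⁴ , s ²) , hpt-nz s

  conicPoint∈H : ∀ s → H (conicPoint s)
  conicPoint∈H s = s , 1# , (0≢1 ∘ sym) ,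
    sym (cong₂ _,_ (*-identityˡ 1#) (cong₂ _,_ (*-identityˡ (s ⁴)) (*-identityˡ (s ²))))

  conicPoint-distinct : ∀ {s t} → s ² ≢ t ² → ¬ SamePoint (conicPoint s) (conicPoint t)
  conicPoint-distinct {s} {t} s²≢t² (λ′ , _ , s≡λ′t) = s²≢t² (begin
    s ²        ≡⟨ cong (proj₂ ∘ proj₂) s≡λ′t ⟩
    λ′ * t ²   ≡⟨ cong (_* t ²) λ′≡1 ⟩
    1# * t ²   ≡⟨ *-identityˡ (t ²) ⟩
    t ²        ∎)
    where
      open ≡-Reasoning
      λ′≡1 : λ′ ≡ 1#
      λ′≡1 = sym (trans (cong proj₁ s≡λ′t) (*-identityʳ λ′))

  covered-by-chord : ∀ P s t → ¬ H P → s ² ≢ t ² →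
                     Collinear P (conicPoint s) (conicPoint t) → Covered H P
  covered-by-chord _ s t P∉H s²≢t² collinear =
    P∉H , conicPoint s , conicPoint t , conicPoint∈H s , conicPoint∈H t , conicPoint-distinct s²≢t² , collinear

  det-U : ∀ b c s t → det (0# , b , c) (1# , s ⁴ , s ²) (1# , t ⁴ , t ²) ≡ (t ² - s ²) * (c * (s ² + t ²) - b)
  det-U = solve 4 (λ b c s t →
    0ᴾ :* ((s :* s) :* (s :* s) :* (t :* t) :- (s :* s) :* ((t :* t) :* (t :* t)))
      :- b :* (1ᴾ :* (t :* t) :- (s :* s) :* 1ᴾ)
      :+ c :* (1ᴾ :* ((t :* t) :* (t :* t)) :- ((s :* s) :* (s :* s)) :* 1ᴾ)
    := ((t :* t) :- (s :* s)) :* (c :* ((s :* s) :+ (t :* t)) :- b)) refl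

  det-V : ∀ a c s t → det (a , 0# , c) (1# , s ⁴ , s ²) (1# , t ⁴ , t ²)
                      ≡ (t ² - s ²) * (c * (s ² + t ²) - a * (s ² * t ²))
  det-V = solve 4 (λ a c s t →
    a :* ((s :* s) :* (s :* s) :* (t :* t) :- (s :* s) :* ((t :* t) :* (t :* t)))
      :- 0ᴾ :* (1ᴾ :* (t :* t) :- (s :* s) :* 1ᴾ)
      :+ c :* (1ᴾ :* ((t :* t) :* (t :* t)) :- ((s :* s) :* (s :* s)) :* 1ᴾ)
    := ((t :* t) :- (s :* s)) :* (c :* ((s :* s) :+ (t :* t)) :- a :* ((s :* s) :* (t :* t)))) refl

  U∉H : ∀ {b c} (nz : NonZero (0# , b , c)) → ¬ H ((0# , b , c) , nz)
  U∉H _ (_ , λ′ , λ′≢0 , U≡λ′h) = λ′≢0 (trans (sym (*-identityʳ λ′)) (sym (cong proj₁ U≡λ′h)))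

  V∉H : ∀ {a c} (nz : NonZero (a , 0# , c)) → c ≢ 0# → ¬ H ((a , 0# , c) , nz)
  V∉H {c = c} _ c≢0 (s , λ′ , λ′≢0 , V≡λ′h) with x*y≡0⇒x≡0⊎y≡0 (sym (cong (proj₁ ∘ proj₂) V≡λ′h))
  ... | inj₁ λ′≡0 = λ′≢0 λ′≡0
  ... | inj₂ s⁴≡0 = c≢0 (begin
    c          ≡⟨ cong (proj₂ ∘ proj₂) V≡λ′h ⟩
    λ′ * s ²   ≡⟨ cong (λ′ *_) (x²≡0⇒x≡0 s⁴≡0) ⟩
    λ′ * 0#    ≡⟨ zeroʳ λ′ ⟩
    0#         ∎)
    where open ≡-Reasoning

  U-collinear : ∀ {b c w s t} → c * w ≡ 1# → s ² + t ² ≡ w * b →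
                det (0# , b , c) (1# , s ⁴ , s ²) (1# , t ⁴ , t ²) ≡ 0#
  U-collinear {b} {c} {w} {s} {t} cw≡1 s²+t²≡wb = begin
    det (0# , b , c) (1# , s ⁴ , s ²) (1# , t ⁴ , t ²)  ≡⟨ det-U b c s t ⟩
    (t ² - s ²) * (c * (s ² + t ²) - b)                ≡⟨ cong (λ u → (t ² - s ²) * (u - b)) c[s²+t²]≡b ⟩
    (t ² - s ²) * (b - b)                              ≡⟨ cong ((t ² - s ²) *_) (-‿inverseʳ b) ⟩
    (t ² - s ²) * 0#                                   ≡⟨ zeroʳ (t ² - s ²) ⟩
    0#                                                 ∎
    where
      open ≡-Reasoning
      c[s²+t²]≡b : c * (s ² + t ²) ≡ b
      c[s²+t²]≡b = trans (cong (c *_) s²+t²≡wb) (x*[w*y]≡y b cw≡1)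

  V-collinear : ∀ {a c w s t} → c * w ≡ 1# → s ² + t ² ≡ (w * a) * (s ² * t ²) →
                det (a , 0# , c) (1# , s ⁴ , s ²) (1# , t ⁴ , t ²) ≡ 0#
  V-collinear {a} {c} {w} {s} {t} cw≡1 s²+t²≡was²t² = begin
    det (a , 0# , c) (1# , s ⁴ , s ²) (1# , t ⁴ , t ²)  ≡⟨ det-V a c s t ⟩
    (t ² - s ²) * (c * (s ² + t ²) - a * (s ² * t ²))  ≡⟨ cong (λ u → (t ² - s ²) * (u - a * (s ² * t ²))) c[s²+t²]≡as²t² ⟩
    (t ² - s ²) * (a * (s ² * t ²) - a * (s ² * t ²))  ≡⟨ cong ((t ² - s ²) *_) (-‿inverseʳ (a * (s ² * t ²))) ⟩
    (t ² - s ²) * 0#                                   ≡⟨ zeroʳ (t ² - s ²) ⟩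
    0#                                                 ∎
    where
      open ≡-Reasoning
      c[s²+t²]≡as²t² : c * (s ² + t ²) ≡ a * (s ² * t ²)
      c[s²+t²]≡as²t² = begin
        c * (s ² + t ²)              ≡⟨ cong (c *_) s²+t²≡was²t² ⟩
        c * ((w * a) * (s ² * t ²))  ≡⟨ solve 4 (λ c w a x → c :* ((w :* a) :* x) := (c :* (w :* a)) :* x) refl c w a (s ² * t ²) ⟩
        (c * (w * a)) * (s ² * t ²)  ≡⟨ cong (_* (s ² * t ²)) (x*[w*y]≡y a cw≡1) ⟩
        a * (s ² * t ²)              ∎

  U-covered : 9 < q → ∀ b c (nz : NonZero (0# , b , c)) → b * c ≢ 0# → Covered H ((0# , b , c) , nz)
  U-covered 9<q b c nz bc≢0 =
    let (w , cw≡1) = inverse c (x*y≢0⇒y≢0 bc≢0)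
        w≢0 = x*y≡1⇒x≢0 (trans (*-comm w c) cw≡1)
        open ProperSumOfTwoSquares (proper-sum-of-two-squares 9<q (x*y≢0 w≢0 (x*y≢0⇒x≢0 bc≢0)))
    in covered-by-chord ((0# , b , c) , nz) s t (U∉H nz) s²≢t² (U-collinear cw≡1 s²+t²≡d)

  V-covered : 9 < q → ∀ a c (nz : NonZero (a , 0# , c)) → a * c ≢ 0# → Covered H ((a , 0# , c) , nz)
  V-covered 9<q a c nz ac≢0 =
    let c≢0 = x*y≢0⇒y≢0 ac≢0
        (w , cw≡1) = inverse c c≢0
        w≢0 = x*y≡1⇒x≢0 (trans (*-comm w c) cw≡1)
        (s , t , s²≢t² , s²+t²≡was²t²) =
          reciprocal-representation (proper-sum-of-two-squares 9<q (x*y≢0 w≢0 (x*y≢0⇒x≢0 ac≢0)))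
    in covered-by-chord ((a , 0# , c) , nz) s t (V∉H nz c≢0) s²≢t² (V-collinear cw≡1 s²+t²≡was²t²)

lemma3p5 : (q : ℕ) → IsPrimePower q → IsOdd q → q ≥ 17 → (F : FiniteField q) →
    let open FiniteField F in
    (∀ (b c : Carrier) (nz : NonZero (0# , b , c)) → b * c ≢ 0# → Covered H ((0# , b , c) , nz))
    × (∀ (a c : Carrier) (nz : NonZero (a , 0# , c)) → a * c ≢ 0# → Covered H ((a , 0# , c) , nz))
lemma3p5 q _ _ q≥17 F = U-covered F 9<q , V-covered F 9<q
  where
    9<q : 9 < q
    9<q = ℕ.≤-trans (ℕ.m≤m+n 10 7) q≥17
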